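{- Let $a,b$ be integers with $a > b \ge 0$, let $k_0,k_1 \in \mathbb{Z}$, and let $S = \{x+yi \in \mathbb{Z}[i] : k_0 \le x < k_0+a,\ k_1 \le y < k_1 + a\}$. If $\alpha+\beta i$ and $c+di$ are distinct elements of $S$, then $\alpha+\beta i \not\equiv c+di \pmod{a+bi}$. -}

module Defs where

open import Data.Integer using (ℤ; _+_; _-_; _*_; _≤_; _<_)
open import Data.Product using (_×_; _,_; ∃)
open import Relation.Binary.PropositionalEquality using (_≡_)

record ℤ[i] : Set where
  constructor _+_i
  field
    re : ℤ
    im : ℤ
open ℤ[i] public

infix 5 _+_i

_-ᵍ_ : ℤ[i] → ℤ[i] → ℤ[i]
(a + b i) -ᵍ (c + d i) = (a - c) + (b - d) i

_*ᵍ_ : ℤ[i] → ℤ[i] → ℤ[i]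
(a + b i) *ᵍ (c + d i) = (a * c - b * d) + (a * d + b * c) i

_∣ᵍ_ : ℤ[i] → ℤ[i] → Set
m ∣ᵍ z = ∃ λ q → z ≡ q *ᵍ m

_≡_[modᵍ_] : ℤ[i] → ℤ[i] → ℤ[i] → Set
z ≡ w [modᵍ m ] = m ∣ᵍ (z -ᵍ w)

InBox : ℤ → ℤ → ℤ → ℤ[i] → Set
InBox a k0 k1 z = (k0 ≤ re z × re z < k0 + a) × (k1 ≤ im z × im z < k1 + a)

-- Write z - w = q (a + b i) with q = p + r i, so that re (z - w) = p a - r b and
-- im (z - w) = p b + r a, both of absolute value < a since z, w lie in the same box.
-- As a > 0 and b ≥ 0, whenever q ≠ 0 one of the two components is a sum P a + Q b
-- with P ≥ 1 and Q ≥ 0, up to sign, hence of absolute value ≥ a; so q = 0 and z = w.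
{-# OPTIONS --safe #-}
module Submission where

open import Defs
open import Data.Integer
  using (ℤ; _+_; _-_; _*_; -_; _≤_; _<_; 0ℤ; 1ℤ; +0; +_; +[1+_]; -[1+_]; +≤+; nonNegative)
open import Data.Integer.Properties
open import Data.Integer.Tactic.RingSolver using (solve-∀)
open import Data.Nat using (suc; z≤n; s≤s)
open import Data.Empty using (⊥-elim)
open import Data.Product using (_×_; _,_)
open import Relation.Binary.PropositionalEquality using (_≡_; refl; sym; cong; cong₂; subst)
open import Relation.Nullary using (¬_)

Small : ℤ → ℤ → Set
Small a w = - a < w × w < a

Small-neg : ∀ {a w} → Small a w → Small a (- w)
Small-neg {a} (-a<w , w<a) = neg-mono-< w<a , subst (_ <_) (neg-involutive a) (neg-mono-< -a<w)

box-diff-Small : ∀ {a k x x′} → k ≤ x → x < k + a → k ≤ x′ → x′ < k + a → Small a (x - x′)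
box-diff-Small {a} {k} {x} {x′} k≤x x<k+a k≤x′ x′<k+a =
    subst (_< x - x′) (k-[k+a]≡-a k a) (+-mono-≤-< k≤x (neg-mono-< x′<k+a))
  , subst (x - x′ <_) ([k+a]-k≡a k a) (+-mono-<-≤ x<k+a (neg-mono-≤ k≤x′))
  where
  k-[k+a]≡-a : ∀ k a → k - (k + a) ≡ - a
  k-[k+a]≡-a = solve-∀
  [k+a]-k≡a : ∀ k a → (k + a) - k ≡ a
  [k+a]-k≡a = solve-∀

≤-positive-combination : ∀ {a b P Q} → 0ℤ ≤ a → 0ℤ ≤ b → 1ℤ ≤ P → 0ℤ ≤ Q → a ≤ P * a + Q * b
≤-positive-combination {a} {b} {P} {Q} 0≤a 0≤b 1≤P 0≤Q = begin
  a              ≡⟨ sym (*-identityˡ a) ⟩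
  1ℤ * a         ≤⟨ *-monoʳ-≤-nonNeg a {{nonNegative 0≤a}} 1≤P ⟩
  P * a          ≡⟨ sym (+-identityʳ (P * a)) ⟩
  P * a + 0ℤ     ≤⟨ +-monoʳ-≤ (P * a) (*-monoʳ-≤-nonNeg b {{nonNegative 0≤b}} 0≤Q) ⟩
  P * a + Q * b  ∎
  where open ≤-Reasoning

¬Small-positive-combination : ∀ {a b w} m n → 0ℤ ≤ a → 0ℤ ≤ b →
                              w ≡ +[1+ m ] * a + + n * b → ¬ Small a w
¬Small-positive-combination m n 0≤a 0≤b refl (_ , w<a) =
  <-irrefl refl (<-≤-trans w<a
    (≤-positive-combination {P = +[1+ m ]} {Q = + n} 0≤a 0≤b (+≤+ (s≤s z≤n)) (+≤+ z≤n)))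

re-as-sum : ∀ p r a b → p * a - r * b ≡ p * a + (- r) * b
re-as-sum = solve-∀

neg-re-as-sum : ∀ p r a b → - (p * a - r * b) ≡ (- p) * a + r * b
neg-re-as-sum = solve-∀

im-as-sum : ∀ p r a b → p * b + r * a ≡ r * a + p * b
im-as-sum = solve-∀

neg-im-as-sum : ∀ p r a b → - (p * b + r * a) ≡ (- r) * a + (- p) * b
neg-im-as-sum = solve-∀

Small-multiple⇒zero : ∀ {a b} p r → 0ℤ ≤ a → 0ℤ ≤ b →
                      Small a (p * a - r * b) → Small a (p * b + r * a) → p ≡ 0ℤ × r ≡ 0ℤ
Small-multiple⇒zero +0 +0 _ _ _ _ = refl , refl
Small-multiple⇒zero {a} {b} p@(+[1+ m ]) r@(+[1+ n ]) 0≤a 0≤b _ v =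
  ⊥-elim (¬Small-positive-combination n (suc m) 0≤a 0≤b (im-as-sum p r a b) v)
Small-multiple⇒zero {a} {b} p@(+[1+ m ]) r@(+0) 0≤a 0≤b u _ =
  ⊥-elim (¬Small-positive-combination m 0 0≤a 0≤b (re-as-sum p r a b) u)
Small-multiple⇒zero {a} {b} p@(+[1+ m ]) r@(-[1+ n ]) 0≤a 0≤b u _ =
  ⊥-elim (¬Small-positive-combination m (suc n) 0≤a 0≤b (re-as-sum p r a b) u)
Small-multiple⇒zero {a} {b} p@(+0) r@(+[1+ n ]) 0≤a 0≤b _ v =
  ⊥-elim (¬Small-positive-combination n 0 0≤a 0≤b (im-as-sum p r a b) v)
Small-multiple⇒zero {a} {b} p@(+0) r@(-[1+ n ]) 0≤a 0≤b _ v =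
  ⊥-elim (¬Small-positive-combination n 0 0≤a 0≤b (neg-im-as-sum p r a b) (Small-neg v))
Small-multiple⇒zero {a} {b} p@(-[1+ m ]) r@(+0) 0≤a 0≤b u _ =
  ⊥-elim (¬Small-positive-combination m 0 0≤a 0≤b (neg-re-as-sum p r a b) (Small-neg u))
Small-multiple⇒zero {a} {b} p@(-[1+ m ]) r@(+[1+ n ]) 0≤a 0≤b u _ =
  ⊥-elim (¬Small-positive-combination m (suc n) 0≤a 0≤b (neg-re-as-sum p r a b) (Small-neg u))
Small-multiple⇒zero {a} {b} p@(-[1+ m ]) r@(-[1+ n ]) 0≤a 0≤b _ v =
  ⊥-elim (¬Small-positive-combination n (suc m) 0≤a 0≤b (neg-im-as-sum p r a b) (Small-neg v))

mainTheorem10 : (a b k0 k1 : ℤ) → b < a → 0ℤ ≤ b →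
    (z w : ℤ[i]) → InBox a k0 k1 z → InBox a k0 k1 w → ¬ (z ≡ w) →
    ¬ (z ≡ w [modᵍ (a + b i) ])
mainTheorem10 a b k0 k1 b<a 0≤b (x + y i) (x′ + y′ i)
  ((k0≤x , x<) , (k1≤y , y<)) ((k0≤x′ , x′<) , (k1≤y′ , y′<)) z≢w ((p + r i) , z-w≡q*m)
  with Small-multiple⇒zero p r (≤-trans 0≤b (<⇒≤ b<a)) 0≤b
         (subst (Small a) (cong re z-w≡q*m) (box-diff-Small k0≤x x< k0≤x′ x′<))
         (subst (Small a) (cong im z-w≡q*m) (box-diff-Small k1≤y y< k1≤y′ y′<))
... | refl , refl =
  z≢w (cong₂ _+_i (i-j≡0⇒i≡j x x′ (cong re z-w≡q*m)) (i-j≡0⇒i≡j y y′ (cong im z-w≡q*m)))
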